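{- Let $r$ be a nonzero integer and $n$ a positive integer. Then $$a(n,r)=\begin{cases}\lfloor e^{1/r}r^n n!+\tfrac12\rfloor & \text{if } r<0,\\ \lfloor e^{1/r}r^n n!\rfloor & \text{if } r>0.\end{cases}$$
   Context: For a positive integer $r$, $C_r$ is the cyclic group of order $r$ and $C_r\wr S_n=\mathrm{Fun}([n],C_r)\rtimes S_n$ acts on $C_r\times[n]$ by $(f,\sigma)(s,m)=(s+f(\sigma(m)),\sigma(m))$. An $r$-cyclic derangement of degree $n$ is an element of $C_r\wr S_n$ with no fixed point on $C_r\times[n]$; an $r$-cyclic arrangement of degree $n$ is a pair of a subset $A\subset[n]$ and an element of $C_r\wr S_{|A|}$. For nonzero integer $r$, $a(n,r)$ is the number of $r$-cyclic arrangements of degree $n$ if $r>0$, and $(-1)^n$ times the number of $|r|$-cyclic derangements of degree $n$ if $r<0$ (equivalently $a(n,r)=\sum_{k=0}^n\binom nk k!r^k$). $\lfloor\cdot\rfloor$ is the floor function on $\mathbb R$. -}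

module Defs where

open import Data.Nat as ℕ using (ℕ; zero; suc)
open import Data.Nat.Combinatorics using (_C_)
open import Data.Nat.Base using (_!)
open import Data.Integer as ℤ using (ℤ; +_; -[1+_]; +[1+_])
open import Data.Rational as ℚ using (ℚ; 0ℚ; 1ℚ; _/_)
open import Data.Product using (Σ; ∃; _×_)

sumℤ : (ℕ → ℤ) → ℕ → ℤ
sumℤ f zero    = + 0
sumℤ f (suc m) = sumℤ f m ℤ.+ f m

a : ℕ → ℤ → ℤ
a n r = sumℤ (λ k → + ((n C k) ℕ.* (k !)) ℤ.* (r ℤ.^ k)) (suc n)

sumℚ : (ℕ → ℚ) → ℕ → ℚ
sumℚ f zero    = 0ℚ
sumℚ f (suc m) = sumℚ f m ℚ.+ f m

_^ℚ_ : ℚ → ℕ → ℚ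
q ^ℚ zero  = 1ℚ
q ^ℚ suc k = (q ^ℚ k) ℚ.* q

-- 1/r as a rational (the value at r = 0 is irrelevant: r ≠ 0 is assumed)
inv : ℤ → ℚ
inv (+ zero)    = 0ℚ
inv +[1+ m ]    = + 1 / suc m
inv -[1+ m ]    = ℤ.- (+ 1) / suc m

expPartial : ℚ → ℕ → ℚ
expPartial q = sumℚ (λ k → (q ^ℚ k) ℚ.* (+ 1 / (k !)) {{k Data.Nat.Properties.!≢0}})
  where import Data.Nat.Properties

-- The real number L = lim s (s a convergent sequence of rationals) is compared
-- with rationals via the sequence:
-- L ≥ q  iff  for every ε > 0, eventually s m ≥ q - ε
LimGe : (ℕ → ℚ) → ℚ → Set
LimGe s q = ∀ (ε : ℚ) → ε ℚ.> 0ℚ → ∃ λ N → ∀ m → N ℕ.≤ m → q ℚ.- ε ℚ.≤ s m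

LimLt : (ℕ → ℚ) → ℚ → Set
LimLt s q = ∃ λ (ε : ℚ) → (ε ℚ.> 0ℚ) × ∃ λ N → ∀ m → N ℕ.≤ m → s m ℚ.+ ε ℚ.≤ q

FloorOfLim : (ℕ → ℚ) → ℤ → Set
FloorOfLim s z = LimGe s (z / 1) × LimLt s ((z ℤ.+ + 1) / 1)

approx : ℕ → ℤ → ℕ → ℚ
approx n r m = ((r ℤ.^ n) ℤ.* + (n !) / 1) ℚ.* expPartial (inv r) m

module Submission where

-- With scale n = rⁿ n! and term k = r⁻ᵏ/k!, induction on n gives scale n · term n = 1 and
-- scale n · (term 0 + ⋯ + term n) = a(n,r), through a(n+1,r) = 1 + (n+1) r a(n,r). So from
-- m = n+1 on, the approximant is a(n,r) plus a partial sum of tail n i = scale n · term (n+1+i),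
-- which starts at 1/(r(n+1)) and has successive ratios 1/(r(n+2+i)). For r > 0 and n ≥ 1 these
-- ratios are at most 1/3 and the first tail term is at most 1/2, so the partial sums lie in
-- [0, 3/4]. For r < 0 the tail alternates with ratios in [-1, 0] from a start in [-1/2, 0], so
-- each partial sum is a convex combination of the two before it and stays in [-1/2, 0].

open import Data.Integer as ℤ using (ℤ; +_; -[1+_]; +[1+_]; 0ℤ)
open import Data.Integer.Tactic.RingSolver using (solve-∀)
open import Data.Nat as ℕ using (ℕ; zero; suc)
open import Data.Nat.Base using (_!)
open import Data.Nat.Combinatorics using (_C_; nCk≡nPk/k!; k>n⇒nCk≡0)
open import Data.Nat.Combinatorics.Base using (_P_; _P′_)
open import Data.Nat.Combinatorics.Specification
  using (k!∣nP′k; nPk≡n!/[n∸k]!; nP′k≡n!/[n∸k]!; nP′k≡n[n∸1P′k∸1])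
open import Data.Nat.DivMod using (m/n*n≡m)
open import Data.Product using (_×_; _,_; proj₁; proj₂)
open import Data.Rational as ℚ using (ℚ; 0ℚ; 1ℚ; _/_; ½; -½; _+_; _*_; -_; _-_; _≤_; _<_)
open import Data.Rational.Solver using (module +-*-Solver)
open import Data.Rational.Unnormalised as ℚᵘ using (mkℚᵘ; *≡*; *≤*)
open import Function using (_∘_)
open import Relation.Binary.PropositionalEquality
open import Relation.Nullary using (yes; no; contradiction)
import Data.Integer.Properties as ℤP
import Data.Nat.Properties as ℕP
import Data.Rational.Properties as ℚP
import Data.Rational.Unnormalised.Properties as ℚᵘP

open import Defs

open +-*-Solver using (solve; _:+_; _:*_; :-_; _:=_; con)

sumℤ-suc : ∀ f m → sumℤ f (suc m) ≡ f 0 ℤ.+ sumℤ (f ∘ suc) m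
sumℤ-suc f zero    = ℤP.+-comm (+ 0) (f 0)
sumℤ-suc f (suc m) = trans (cong (ℤ._+ f (suc m)) (sumℤ-suc f m)) (ℤP.+-assoc (f 0) _ _)

sumℤ-cong : ∀ {f g} → (∀ k → f k ≡ g k) → ∀ m → sumℤ f m ≡ sumℤ g m
sumℤ-cong f≗g zero    = refl
sumℤ-cong f≗g (suc m) = cong₂ ℤ._+_ (sumℤ-cong f≗g m) (f≗g m)

sumℤ-*-distribˡ : ∀ c f m → sumℤ (λ k → c ℤ.* f k) m ≡ c ℤ.* sumℤ f m
sumℤ-*-distribˡ c f zero    = sym (ℤP.*-zeroʳ c)
sumℤ-*-distribˡ c f (suc m) = trans (cong (ℤ._+ c ℤ.* f m) (sumℤ-*-distribˡ c f m))
  (sym (ℤP.*-distribˡ-+ c (sumℤ f m) (f m)))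

sumℚ-+ : ∀ f k m → sumℚ f (k ℕ.+ m) ≡ sumℚ f m + sumℚ (λ i → f (i ℕ.+ m)) k
sumℚ-+ f zero    m = sym (ℚP.+-identityʳ (sumℚ f m))
sumℚ-+ f (suc k) m = trans (cong (_+ f (k ℕ.+ m)) (sumℚ-+ f k m)) (ℚP.+-assoc (sumℚ f m) _ _)

sumℚ-*-distribˡ : ∀ c f k → c * sumℚ f k ≡ sumℚ (λ i → c * f i) k
sumℚ-*-distribˡ c f zero    = ℚP.*-zeroʳ c
sumℚ-*-distribˡ c f (suc k) = trans (ℚP.*-distribˡ-+ c (sumℚ f k) (f k))
  (cong (_+ c * f k) (sumℚ-*-distribˡ c f k))

sumℚ-nonNeg : ∀ {f} → (∀ i → 0ℚ ≤ f i) → ∀ k → 0ℚ ≤ sumℚ f k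
sumℚ-nonNeg f≥0 zero    = ℚP.≤-refl
sumℚ-nonNeg f≥0 (suc k) = ℚP.+-mono-≤ (sumℚ-nonNeg f≥0 k) (f≥0 k)

nPk≡nP′k : ∀ {n k} → k ℕ.≤ n → n P k ≡ n P′ k
nPk≡nP′k k≤n = trans (nPk≡n!/[n∸k]! k≤n) (sym (nP′k≡n!/[n∸k]! k≤n))

nCk*k!≡nP′k : ∀ {n k} → k ℕ.≤ n → (n C k) ℕ.* k ! ≡ n P′ k
nCk*k!≡nP′k {n} {k} k≤n = begin
  (n C k) ℕ.* k !           ≡⟨ cong (ℕ._* k !) (nCk≡nPk/k! k≤n) ⟩
  ((n P k) ℕ./ k !) ℕ.* k !  ≡⟨ cong (λ x → x ℕ./ k ! ℕ.* k !) (nPk≡nP′k k≤n) ⟩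
  ((n P′ k) ℕ./ k !) ℕ.* k ! ≡⟨ m/n*n≡m (k!∣nP′k k≤n) ⟩
  n P′ k                  ∎
  where open ≡-Reasoning; instance _ = k ℕP.!≢0

[1+n]C[1+k]*[1+k]!≡[1+n]*nCk*k! : ∀ n k →
  (suc n C suc k) ℕ.* suc k ! ≡ suc n ℕ.* ((n C k) ℕ.* k !)
[1+n]C[1+k]*[1+k]!≡[1+n]*nCk*k! n k with k ℕP.≤? n
... | yes k≤n = begin
  (suc n C suc k) ℕ.* suc k ! ≡⟨ nCk*k!≡nP′k (ℕ.s≤s k≤n) ⟩
  suc n P′ suc k           ≡⟨ nP′k≡n[n∸1P′k∸1] (suc n) (suc k) ⟩
  suc n ℕ.* (n P′ k)        ≡⟨ cong (suc n ℕ.*_) (nCk*k!≡nP′k k≤n) ⟨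
  suc n ℕ.* ((n C k) ℕ.* k !) ∎
  where open ≡-Reasoning
... | no k≰n = begin
  (suc n C suc k) ℕ.* suc k ! ≡⟨ cong (ℕ._* suc k !) (k>n⇒nCk≡0 (ℕ.s≤s k>n)) ⟩
  0                        ≡⟨ ℕP.*-zeroʳ (suc n) ⟨
  suc n ℕ.* 0              ≡⟨ cong (λ x → suc n ℕ.* (x ℕ.* k !)) (k>n⇒nCk≡0 k>n) ⟨
  suc n ℕ.* ((n C k) ℕ.* k !) ∎
  where
  open ≡-Reasoning
  k>n : k ℕ.> n
  k>n = ℕP.≰⇒> k≰n

a-suc : ∀ n r → a (suc n) r ≡ + 1 ℤ.+ (+ suc n ℤ.* r) ℤ.* a n r
a-suc n r = begin
  a (suc n) r
    ≡⟨ sumℤ-suc _ (suc n) ⟩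
  + 1 ℤ.+ sumℤ (λ k → + ((suc n C suc k) ℕ.* suc k !) ℤ.* r ℤ.^ suc k) (suc n)
    ≡⟨ cong (ℤ._+_ (+ 1)) (sumℤ-cong summand-suc (suc n)) ⟩
  + 1 ℤ.+ sumℤ (λ k → (+ suc n ℤ.* r) ℤ.* (+ ((n C k) ℕ.* k !) ℤ.* r ℤ.^ k)) (suc n)
    ≡⟨ cong (ℤ._+_ (+ 1)) (sumℤ-*-distribˡ (+ suc n ℤ.* r) _ (suc n)) ⟩
  + 1 ℤ.+ (+ suc n ℤ.* r) ℤ.* a n r ∎
  where
  open ≡-Reasoning
  swap : ∀ x y z w → (x ℤ.* y) ℤ.* (z ℤ.* w) ≡ (x ℤ.* z) ℤ.* (y ℤ.* w)
  swap = solve-∀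
  summand-suc : ∀ k → + ((suc n C suc k) ℕ.* suc k !) ℤ.* r ℤ.^ suc k
                 ≡ (+ suc n ℤ.* r) ℤ.* (+ ((n C k) ℕ.* k !) ℤ.* r ℤ.^ k)
  summand-suc k = begin
    + ((suc n C suc k) ℕ.* suc k !) ℤ.* (r ℤ.* r ℤ.^ k)
      ≡⟨ cong (λ x → + x ℤ.* (r ℤ.* r ℤ.^ k)) ([1+n]C[1+k]*[1+k]!≡[1+n]*nCk*k! n k) ⟩
    + (suc n ℕ.* ((n C k) ℕ.* k !)) ℤ.* (r ℤ.* r ℤ.^ k)
      ≡⟨ cong (ℤ._* (r ℤ.* r ℤ.^ k)) (ℤP.pos-* (suc n) ((n C k) ℕ.* k !)) ⟩
    (+ suc n ℤ.* + ((n C k) ℕ.* k !)) ℤ.* (r ℤ.* r ℤ.^ k)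
      ≡⟨ swap (+ suc n) (+ ((n C k) ℕ.* k !)) r (r ℤ.^ k) ⟩
    (+ suc n ℤ.* r) ℤ.* (+ ((n C k) ℕ.* k !) ℤ.* r ℤ.^ k) ∎

fromℤ : ℤ → ℚ
fromℤ z = z / 1

toℚᵘ-/ : ∀ z d .{{_ : ℕ.NonZero d}} → ℚ.toℚᵘ (z / d) ℚᵘ.≃ z ℚᵘ./ d
toℚᵘ-/ z (suc d) = ℚP.toℚᵘ-fromℚᵘ (mkℚᵘ z d)

fromℤ-homo-+ : ∀ x y → fromℤ (x ℤ.+ y) ≡ fromℤ x + fromℤ y
fromℤ-homo-+ x y = ℚP.toℚᵘ-injective (begin
  ℚ.toℚᵘ (fromℤ (x ℤ.+ y))                ≈⟨ toℚᵘ-/ (x ℤ.+ y) 1 ⟩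
  mkℚᵘ (x ℤ.+ y) 0                        ≈⟨ *≡* (identity x y) ⟩
  mkℚᵘ x 0 ℚᵘ.+ mkℚᵘ y 0                   ≈⟨ ℚᵘP.+-cong (toℚᵘ-/ x 1) (toℚᵘ-/ y 1) ⟨
  ℚ.toℚᵘ (fromℤ x) ℚᵘ.+ ℚ.toℚᵘ (fromℤ y)   ≈⟨ ℚP.toℚᵘ-homo-+ (fromℤ x) (fromℤ y) ⟨
  ℚ.toℚᵘ (fromℤ x + fromℤ y)              ∎)
  where
  open ℚᵘP.≃-Reasoning
  identity : ∀ x y → (x ℤ.+ y) ℤ.* + 1 ≡ (x ℤ.* + 1 ℤ.+ y ℤ.* + 1) ℤ.* + 1
  identity = solve-∀

fromℤ-homo-* : ∀ x y → fromℤ (x ℤ.* y) ≡ fromℤ x * fromℤ y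
fromℤ-homo-* x y = ℚP.toℚᵘ-injective (begin
  ℚ.toℚᵘ (fromℤ (x ℤ.* y))                ≈⟨ toℚᵘ-/ (x ℤ.* y) 1 ⟩
  mkℚᵘ (x ℤ.* y) 0                        ≈⟨ ℚᵘP.*-cong (toℚᵘ-/ x 1) (toℚᵘ-/ y 1) ⟨
  ℚ.toℚᵘ (fromℤ x) ℚᵘ.* ℚ.toℚᵘ (fromℤ y)   ≈⟨ ℚP.toℚᵘ-homo-* (fromℤ x) (fromℤ y) ⟨
  ℚ.toℚᵘ (fromℤ x * fromℤ y)              ∎)
  where open ℚᵘP.≃-Reasoning

1/[m*n]≡1/m*1/n : ∀ m n .{{_ : ℕ.NonZero m}} .{{_ : ℕ.NonZero n}} →
  (+ 1 / (m ℕ.* n)) {{ℕP.m*n≢0 m n}} ≡ (+ 1 / m) * (+ 1 / n)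
1/[m*n]≡1/m*1/n m@(suc _) n@(suc _) = ℚP.toℚᵘ-injective (begin
  ℚ.toℚᵘ (+ 1 / (m ℕ.* n))                ≈⟨ toℚᵘ-/ (+ 1) (m ℕ.* n) ⟩
  + 1 ℚᵘ./ (m ℕ.* n)                      ≈⟨ ℚᵘP.*-cong (toℚᵘ-/ (+ 1) m) (toℚᵘ-/ (+ 1) n) ⟨
  ℚ.toℚᵘ (+ 1 / m) ℚᵘ.* ℚ.toℚᵘ (+ 1 / n)   ≈⟨ ℚP.toℚᵘ-homo-* (+ 1 / m) (+ 1 / n) ⟨
  ℚ.toℚᵘ ((+ 1 / m) * (+ 1 / n))          ∎)
  where open ℚᵘP.≃-Reasoning

fromℤ*[w/d]≡1 : ∀ z w d .{{_ : ℕ.NonZero d}} → z ℤ.* w ≡ + d →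
  fromℤ z * (w / d) ≡ 1ℚ
fromℤ*[w/d]≡1 z w d@(suc _) zw≡d = ℚP.toℚᵘ-injective (begin
  ℚ.toℚᵘ (fromℤ z * (w / d))             ≈⟨ ℚP.toℚᵘ-homo-* (fromℤ z) (w / d) ⟩
  ℚ.toℚᵘ (fromℤ z) ℚᵘ.* ℚ.toℚᵘ (w / d)   ≈⟨ ℚᵘP.*-cong (toℚᵘ-/ z 1) (toℚᵘ-/ w d) ⟩
  (z ℚᵘ./ 1) ℚᵘ.* (w ℚᵘ./ d)             ≈⟨ *≡* cross-multiplied ⟩
  ℚᵘ.1ℚᵘ                                 ∎)
  where
  open ℚᵘP.≃-Reasoning
  cross-multiplied : (z ℤ.* w) ℤ.* + 1 ≡ + 1 ℤ.* + (1 ℕ.* d)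
  cross-multiplied = trans (ℤP.*-identityʳ (z ℤ.* w))
    (trans zw≡d (cong +_ (sym (trans (ℕP.*-identityˡ (1 ℕ.* d)) (ℕP.*-identityˡ d)))))

fromℤ*inv≡1 : ∀ r → r ≢ 0ℤ → fromℤ r * inv r ≡ 1ℚ
fromℤ*inv≡1 (+ zero) r≢0 = contradiction refl r≢0
fromℤ*inv≡1 +[1+ m ] _   =
  fromℤ*[w/d]≡1 +[1+ m ] (+ 1) (suc m) (cong +_ (ℕP.*-identityʳ (suc m)))
fromℤ*inv≡1 -[1+ m ] _   =
  fromℤ*[w/d]≡1 -[1+ m ] -[1+ 0 ] (suc m) (cong +_ (ℕP.*-identityʳ (suc m)))

1/n-nonNeg : ∀ n .{{_ : ℕ.NonZero n}} → 0ℚ ≤ + 1 / n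
1/n-nonNeg (suc n) = ℚP.toℚᵘ-cancel-≤
  (ℚᵘP.≤-respʳ-≃ (ℚᵘP.≃-sym (toℚᵘ-/ (+ 1) (suc n))) (*≤* (ℤ.+≤+ ℕ.z≤n)))

1/n-antimono-≤ : ∀ m n .{{_ : ℕ.NonZero m}} .{{_ : ℕ.NonZero n}} →
  m ℕ.≤ n → + 1 / n ≤ + 1 / m
1/n-antimono-≤ (suc m) (suc n) m≤n = ℚP.toℚᵘ-cancel-≤
  (ℚᵘP.≤-respˡ-≃ (ℚᵘP.≃-sym (toℚᵘ-/ (+ 1) (suc n)))
  (ℚᵘP.≤-respʳ-≃ (ℚᵘP.≃-sym (toℚᵘ-/ (+ 1) (suc m)))
  (*≤* (subst₂ ℤ._≤_ (sym (ℤP.*-identityˡ _)) (sym (ℤP.*-identityˡ _)) (ℤ.+≤+ m≤n)))))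

module ExpSeries (r : ℤ) (r≢0 : r ≢ 0ℤ) where

  term : ℕ → ℚ
  term k = (inv r ^ℚ k) * (+ 1 / (k !)) {{k ℕP.!≢0}}

  ratio : ℕ → ℚ
  ratio k = inv r * (+ 1 / suc k)

  scale : ℕ → ℚ
  scale n = fromℤ (r ℤ.^ n ℤ.* + (n !))

  tail : ℕ → ℕ → ℚ
  tail n i = scale n * term (i ℕ.+ suc n)

  term-suc : ∀ k → term (suc k) ≡ term k * ratio k
  term-suc k = begin
    (inv r ^ℚ k * inv r) * (+ 1 / (suc k !)) {{suc k ℕP.!≢0}}
      ≡⟨ cong ((inv r ^ℚ k * inv r) *_) (1/[m*n]≡1/m*1/n (suc k) (k !) {{_}} {{k ℕP.!≢0}}) ⟩
    (inv r ^ℚ k * inv r) * ((+ 1 / suc k) * (+ 1 / (k !)) {{k ℕP.!≢0}})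
      ≡⟨ regroup (inv r ^ℚ k) (inv r) (+ 1 / suc k) ((+ 1 / (k !)) {{k ℕP.!≢0}}) ⟩
    term k * ratio k ∎
    where
    open ≡-Reasoning
    regroup : ∀ p i d f → (p * i) * (d * f) ≡ (p * f) * (i * d)
    regroup = solve 4 (λ p i d f → (p :* i) :* (d :* f) := (p :* f) :* (i :* d)) refl

  scale-suc : ∀ n → scale (suc n) ≡ scale n * (fromℤ r * fromℤ (+ suc n))
  scale-suc n = begin
    fromℤ ((r ℤ.* r ℤ.^ n) ℤ.* + (suc n ℕ.* n !))
      ≡⟨ cong (λ x → fromℤ ((r ℤ.* r ℤ.^ n) ℤ.* x)) (ℤP.pos-* (suc n) (n !)) ⟩
    fromℤ ((r ℤ.* r ℤ.^ n) ℤ.* (+ suc n ℤ.* + (n !)))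
      ≡⟨ cong fromℤ (regroup r (r ℤ.^ n) (+ suc n) (+ (n !))) ⟩
    fromℤ ((r ℤ.^ n ℤ.* + (n !)) ℤ.* (r ℤ.* + suc n))
      ≡⟨ fromℤ-homo-* (r ℤ.^ n ℤ.* + (n !)) (r ℤ.* + suc n) ⟩
    scale n * fromℤ (r ℤ.* + suc n)
      ≡⟨ cong (scale n *_) (fromℤ-homo-* r (+ suc n)) ⟩
    scale n * (fromℤ r * fromℤ (+ suc n)) ∎
    where
    open ≡-Reasoning
    regroup : ∀ x y z w → (x ℤ.* y) ℤ.* (z ℤ.* w) ≡ (y ℤ.* w) ℤ.* (x ℤ.* z)
    regroup = solve-∀

  scale*term≡1 : ∀ n → scale n * term n ≡ 1ℚ
  scale*term≡1 zero    = refl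
  scale*term≡1 (suc n) = begin
    scale (suc n) * term (suc n)
      ≡⟨ cong₂ _*_ (scale-suc n) (term-suc n) ⟩
    (scale n * (fromℤ r * fromℤ (+ suc n))) * (term n * (inv r * (+ 1 / suc n)))
      ≡⟨ regroup (scale n) (fromℤ r) (fromℤ (+ suc n)) (term n) (inv r) (+ 1 / suc n) ⟩
    (scale n * term n) * ((fromℤ r * inv r) * (fromℤ (+ suc n) * (+ 1 / suc n)))
      ≡⟨ cong₂ (λ x y → x * (y * (fromℤ (+ suc n) * (+ 1 / suc n))))
               (scale*term≡1 n) (fromℤ*inv≡1 r r≢0) ⟩
    1ℚ * (1ℚ * (fromℤ (+ suc n) * (+ 1 / suc n)))
      ≡⟨ cong (λ x → 1ℚ * (1ℚ * x)) (fromℤ*inv≡1 (+ suc n) (λ ())) ⟩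
    1ℚ ∎
    where
    open ≡-Reasoning
    regroup : ∀ k x y e i c → (k * (x * y)) * (e * (i * c)) ≡ (k * e) * ((x * i) * (y * c))
    regroup = solve 6 (λ k x y e i c →
      (k :* (x :* y)) :* (e :* (i :* c)) := (k :* e) :* ((x :* i) :* (y :* c))) refl

  scale*partialSum≡a : ∀ n → scale n * sumℚ term (suc n) ≡ fromℤ (a n r)
  scale*partialSum≡a zero    = refl
  scale*partialSum≡a (suc n) = begin
    scale (suc n) * (sumℚ term (suc n) + term (suc n))
      ≡⟨ ℚP.*-distribˡ-+ (scale (suc n)) _ _ ⟩
    scale (suc n) * sumℚ term (suc n) + scale (suc n) * term (suc n)
      ≡⟨ cong₂ (λ x y → x * sumℚ term (suc n) + y) (scale-suc n) (scale*term≡1 (suc n)) ⟩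
    (scale n * (fromℤ r * fromℤ (+ suc n))) * sumℚ term (suc n) + 1ℚ
      ≡⟨ regroup (scale n) (fromℤ r) (fromℤ (+ suc n)) (sumℚ term (suc n)) ⟩
    1ℚ + (fromℤ (+ suc n) * fromℤ r) * (scale n * sumℚ term (suc n))
      ≡⟨ cong (λ x → 1ℚ + (fromℤ (+ suc n) * fromℤ r) * x) (scale*partialSum≡a n) ⟩
    1ℚ + (fromℤ (+ suc n) * fromℤ r) * fromℤ (a n r)
      ≡⟨ cong (λ x → 1ℚ + x * fromℤ (a n r)) (fromℤ-homo-* (+ suc n) r) ⟨
    1ℚ + fromℤ (+ suc n ℤ.* r) * fromℤ (a n r)
      ≡⟨ cong (_+_ 1ℚ) (fromℤ-homo-* (+ suc n ℤ.* r) (a n r)) ⟨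
    fromℤ (+ 1) + fromℤ ((+ suc n ℤ.* r) ℤ.* a n r)
      ≡⟨ fromℤ-homo-+ (+ 1) ((+ suc n ℤ.* r) ℤ.* a n r) ⟨
    fromℤ (+ 1 ℤ.+ (+ suc n ℤ.* r) ℤ.* a n r)
      ≡⟨ cong fromℤ (a-suc n r) ⟨
    fromℤ (a (suc n) r) ∎
    where
    open ≡-Reasoning
    regroup : ∀ k x y s → (k * (x * y)) * s + 1ℚ ≡ 1ℚ + (y * x) * (k * s)
    regroup = solve 4 (λ k x y s →
      (k :* (x :* y)) :* s :+ con 1ℚ := con 1ℚ :+ (y :* x) :* (k :* s)) refl

  tail-zero : ∀ n → tail n 0 ≡ ratio n
  tail-zero n = begin
    scale n * term (suc n)          ≡⟨ cong (scale n *_) (term-suc n) ⟩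
    scale n * (term n * ratio n)    ≡⟨ ℚP.*-assoc (scale n) (term n) (ratio n) ⟨
    (scale n * term n) * ratio n    ≡⟨ cong (_* ratio n) (scale*term≡1 n) ⟩
    1ℚ * ratio n                    ≡⟨ ℚP.*-identityˡ (ratio n) ⟩
    ratio n                         ∎
    where open ≡-Reasoning

  tail-suc : ∀ n i → tail n (suc i) ≡ tail n i * ratio (i ℕ.+ suc n)
  tail-suc n i = trans (cong (scale n *_) (term-suc (i ℕ.+ suc n))) (sym (ℚP.*-assoc (scale n) _ _))

  approx≡a+tail : ∀ n k → approx n r (k ℕ.+ suc n) ≡ fromℤ (a n r) + sumℚ (tail n) k
  approx≡a+tail n k = begin
    scale n * sumℚ term (k ℕ.+ suc n)
      ≡⟨ cong (scale n *_) (sumℚ-+ term k (suc n)) ⟩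
    scale n * (sumℚ term (suc n) + sumℚ (λ i → term (i ℕ.+ suc n)) k)
      ≡⟨ ℚP.*-distribˡ-+ (scale n) _ _ ⟩
    scale n * sumℚ term (suc n) + scale n * sumℚ (λ i → term (i ℕ.+ suc n)) k
      ≡⟨ cong₂ _+_ (scale*partialSum≡a n) (sumℚ-*-distribˡ (scale n) _ k) ⟩
    fromℤ (a n r) + sumℚ (tail n) k ∎
    where open ≡-Reasoning

*-nonNeg : ∀ {x y} → 0ℚ ≤ x → 0ℚ ≤ y → 0ℚ ≤ x * y
*-nonNeg {x} {y} x≥0 y≥0 = ℚP.nonNegative⁻¹ (x * y)
  {{ℚP.nonNeg*nonNeg⇒nonNeg x {{ℚ.nonNegative x≥0}} y {{ℚ.nonNegative y≥0}}}}

*-monoˡ-≤-nonNeg : ∀ {x y z} → 0ℚ ≤ x → y ≤ z → x * y ≤ x * z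
*-monoˡ-≤-nonNeg {x} x≥0 = ℚP.*-monoˡ-≤-nonNeg x {{ℚ.nonNegative x≥0}}

ratio-nonNeg : ∀ (v : ℕ → ℚ) {c : ℕ → ℚ} → (∀ i → v (suc i) ≡ v i * c i) →
  (∀ i → 0ℚ ≤ c i) → 0ℚ ≤ v 0 → ∀ i → 0ℚ ≤ v i
ratio-nonNeg v v-suc c≥0 v₀≥0 zero    = v₀≥0
ratio-nonNeg v v-suc c≥0 v₀≥0 (suc i) =
  subst (0ℚ ≤_) (sym (v-suc i)) (*-nonNeg (ratio-nonNeg v v-suc c≥0 v₀≥0 i) (c≥0 i))

sumℚ+t*v≤t*v₀ : ∀ t (v : ℕ → ℚ) → (∀ k → v k + t * v (suc k) ≤ t * v k) →
  ∀ k → sumℚ v k + t * v k ≤ t * v 0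
sumℚ+t*v≤t*v₀ t v step zero    = ℚP.≤-reflexive (ℚP.+-identityˡ (t * v 0))
sumℚ+t*v≤t*v₀ t v step (suc k) = begin
  sumℚ v k + v k + t * v (suc k)    ≡⟨ ℚP.+-assoc (sumℚ v k) (v k) _ ⟩
  sumℚ v k + (v k + t * v (suc k))  ≤⟨ ℚP.+-monoʳ-≤ (sumℚ v k) (step k) ⟩
  sumℚ v k + t * v k                ≤⟨ sumℚ+t*v≤t*v₀ t v step k ⟩
  t * v 0                           ∎
  where open ℚP.≤-Reasoning

ratio≤⅓⇒sumℚ≤3/2*v₀ : ∀ (v : ℕ → ℚ) {c : ℕ → ℚ} → (∀ i → v (suc i) ≡ v i * c i) →
  (∀ i → 0ℚ ≤ c i) → (∀ i → c i ≤ + 1 / 3) → 0ℚ ≤ v 0 → ∀ k → sumℚ v k ≤ (+ 3 / 2) * v 0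
ratio≤⅓⇒sumℚ≤3/2*v₀ v {c} v-suc c≥0 c≤⅓ v₀≥0 k = begin
  sumℚ v k                    ≡⟨ ℚP.+-identityʳ (sumℚ v k) ⟨
  sumℚ v k + 0ℚ               ≤⟨ ℚP.+-monoʳ-≤ (sumℚ v k) (*-nonNeg t≥0 (v≥0 k)) ⟩
  sumℚ v k + t * v k          ≤⟨ sumℚ+t*v≤t*v₀ t v step k ⟩
  t * v 0                     ∎
  where
  open ℚP.≤-Reasoning
  -- the fixed point of t ↦ 1 + t/3, so that each step of the telescoping bound closes
  t : ℚ
  t = + 3 / 2
  t≥0 : 0ℚ ≤ t
  t≥0 = ℚP.nonNegative⁻¹ t
  v≥0 : ∀ i → 0ℚ ≤ v i
  v≥0 = ratio-nonNeg v v-suc c≥0 v₀≥0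
  identity : ∀ x → x + t * (x * (+ 1 / 3)) ≡ t * x
  identity = solve 1 (λ x → x :+ con t :* (x :* con (+ 1 / 3)) := con t :* x) refl
  step : ∀ k → v k + t * v (suc k) ≤ t * v k
  step k = begin
    v k + t * v (suc k)           ≡⟨ cong (λ x → v k + t * x) (v-suc k) ⟩
    v k + t * (v k * c k)
      ≤⟨ ℚP.+-monoʳ-≤ (v k) (*-monoˡ-≤-nonNeg t≥0 (*-monoˡ-≤-nonNeg (v≥0 k) (c≤⅓ k))) ⟩
    v k + t * (v k * (+ 1 / 3))   ≡⟨ identity (v k) ⟩
    t * v k                       ∎

Between : ℚ → ℚ → ℚ → Set
Between lo hi x = lo ≤ x × x ≤ hi

between-convex : ∀ {lo hi x y} l → 0ℚ ≤ l → l ≤ 1ℚ → Between lo hi x → Between lo hi y →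
  Between lo hi (l * x + (1ℚ - l) * y)
between-convex {lo} {hi} {x} {y} l l≥0 l≤1 (lo≤x , x≤hi) (lo≤y , y≤hi) =
  subst (_≤ l * x + (1ℚ - l) * y) (combination lo) (combination-mono lo≤x lo≤y) ,
  subst (l * x + (1ℚ - l) * y ≤_) (combination hi) (combination-mono x≤hi y≤hi)
  where
  1-l≥0 : 0ℚ ≤ 1ℚ - l
  1-l≥0 = subst (_≤ 1ℚ - l) (ℚP.+-inverseʳ l) (ℚP.+-monoˡ-≤ (- l) l≤1)
  combination : ∀ z → l * z + (1ℚ - l) * z ≡ z
  combination = solve 2 (λ l z → l :* z :+ (con 1ℚ :+ :- l) :* z := z) refl l
  combination-mono : ∀ {x x′ y y′} → x ≤ x′ → y ≤ y′ →
    l * x + (1ℚ - l) * y ≤ l * x′ + (1ℚ - l) * y′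
  combination-mono x≤x′ y≤y′ =
    ℚP.+-mono-≤ (*-monoˡ-≤-nonNeg l≥0 x≤x′) (*-monoˡ-≤-nonNeg 1-l≥0 y≤y′)

alternating-sumℚ-between : ∀ {lo hi} (v : ℕ → ℚ) {q : ℕ → ℚ} → (∀ i → v (suc i) ≡ v i * - q i) →
  (∀ i → 0ℚ ≤ q i) → (∀ i → q i ≤ 1ℚ) → Between lo hi 0ℚ → Between lo hi (v 0) →
  ∀ k → Between lo hi (sumℚ v k) × Between lo hi (sumℚ v (suc k))
alternating-sumℚ-between {lo} {hi} v v-suc q≥0 q≤1 0∈ v₀∈ zero =
  0∈ , subst (Between lo hi) (sym (ℚP.+-identityˡ (v 0))) v₀∈
alternating-sumℚ-between {lo} {hi} v {q} v-suc q≥0 q≤1 0∈ v₀∈ (suc k)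
  with alternating-sumℚ-between v v-suc q≥0 q≤1 0∈ v₀∈ k
... | S∈ , S+v∈ = S+v∈ ,
  subst (Between lo hi) (sym next≡convex) (between-convex (q k) (q≥0 k) (q≤1 k) S∈ S+v∈)
  where
  identity : ∀ S x q → S + x + x * - q ≡ q * S + (1ℚ - q) * (S + x)
  identity = solve 3 (λ S x q →
    S :+ x :+ x :* (:- q) := q :* S :+ (con 1ℚ :+ :- q) :* (S :+ x)) refl
  next≡convex : sumℚ v k + v k + v (suc k) ≡ q k * sumℚ v k + (1ℚ - q k) * (sumℚ v k + v k)
  next≡convex = trans (cong (_+_ (sumℚ v k + v k)) (v-suc k)) (identity (sumℚ v k) (v k) (q k))

floorOfLim-intro : ∀ (s : ℕ → ℚ) z N (T : ℕ → ℚ) ε → 0ℚ < ε →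
  (∀ k → s (k ℕ.+ N) ≡ fromℤ z + T k) → (∀ k → 0ℚ ≤ T k) → (∀ k → T k + ε ≤ 1ℚ) →
  FloorOfLim s z
floorOfLim-intro s z N T ε ε>0 s≡z+T T≥0 T+ε≤1 = z≤lim , (ε , ε>0 , N , lim<z+1)
  where
  open ℚP.≤-Reasoning
  s≡z+T′ : ∀ m → N ℕ.≤ m → s m ≡ fromℤ z + T (m ℕ.∸ N)
  s≡z+T′ m N≤m = trans (cong s (sym (ℕP.m∸n+n≡m N≤m))) (s≡z+T (m ℕ.∸ N))
  z≤lim : LimGe s (fromℤ z)
  z≤lim δ δ>0 = N , λ m N≤m → begin
    fromℤ z - δ               ≤⟨ ℚP.+-monoʳ-≤ (fromℤ z) (ℚP.neg-antimono-≤ (ℚP.<⇒≤ δ>0)) ⟩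
    fromℤ z + 0ℚ              ≤⟨ ℚP.+-monoʳ-≤ (fromℤ z) (T≥0 (m ℕ.∸ N)) ⟩
    fromℤ z + T (m ℕ.∸ N)     ≡⟨ s≡z+T′ m N≤m ⟨
    s m                       ∎
  lim<z+1 : ∀ m → N ℕ.≤ m → s m + ε ≤ fromℤ (z ℤ.+ + 1)
  lim<z+1 m N≤m = begin
    s m + ε                     ≡⟨ cong (_+ ε) (s≡z+T′ m N≤m) ⟩
    fromℤ z + T (m ℕ.∸ N) + ε   ≡⟨ ℚP.+-assoc (fromℤ z) _ ε ⟩
    fromℤ z + (T (m ℕ.∸ N) + ε) ≤⟨ ℚP.+-monoʳ-≤ (fromℤ z) (T+ε≤1 (m ℕ.∸ N)) ⟩
    fromℤ z + 1ℚ                ≡⟨ fromℤ-homo-+ z (+ 1) ⟨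
    fromℤ (z ℤ.+ + 1)           ∎

inv+[1+p]*1/[1+k]≡1/[[1+p]*[1+k]] : ∀ p k →
  inv +[1+ p ] * (+ 1 / suc k) ≡ + 1 / (suc p ℕ.* suc k)
inv+[1+p]*1/[1+k]≡1/[[1+p]*[1+k]] p k = sym (1/[m*n]≡1/m*1/n (suc p) (suc k))

inv-[1+p]*1/[1+k]≡-1/[[1+p]*[1+k]] : ∀ p k →
  inv -[1+ p ] * (+ 1 / suc k) ≡ - (+ 1 / (suc p ℕ.* suc k))
inv-[1+p]*1/[1+k]≡-1/[[1+p]*[1+k]] p k = trans (sym (ℚP.neg-distribˡ-* (+ 1 / suc p) (+ 1 / suc k)))
  (cong -_ (inv+[1+p]*1/[1+k]≡1/[[1+p]*[1+k]] p k))

2≤[1+p]*[1+n] : ∀ p n → 1 ℕ.≤ n → 2 ℕ.≤ suc p ℕ.* suc n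
2≤[1+p]*[1+n] p n n≥1 = ℕP.≤-trans (ℕ.s≤s n≥1) (ℕP.m≤n*m (suc n) (suc p))

3≤[1+p]*[2+i+n] : ∀ p i n → 1 ℕ.≤ n → 3 ℕ.≤ suc p ℕ.* suc (i ℕ.+ suc n)
3≤[1+p]*[2+i+n] p i n n≥1 = ℕP.≤-trans (ℕ.s≤s (ℕP.≤-trans (ℕ.s≤s n≥1) (ℕP.m≤n+m (suc n) i)))
  (ℕP.m≤n*m (suc (i ℕ.+ suc n)) (suc p))

floor-approx-pos : ∀ p n → 1 ℕ.≤ n → FloorOfLim (approx n +[1+ p ]) (a n +[1+ p ])
floor-approx-pos p n n≥1 = floorOfLim-intro _ (a n r) (suc n) (sumℚ (tail n)) (+ 1 / 4)
  (ℚ.*<* (ℤ.+<+ (ℕ.s≤s ℕ.z≤n))) (approx≡a+tail n) (sumℚ-nonNeg tail≥0) tail-sum+¼≤1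
  where
  r : ℤ
  r = +[1+ p ]
  open ExpSeries r (λ ())
  tail-ratio : ℕ → ℚ
  tail-ratio i = ratio (i ℕ.+ suc n)
  tail-ratio≥0 : ∀ i → 0ℚ ≤ tail-ratio i
  tail-ratio≥0 i = subst (0ℚ ≤_) (sym (inv+[1+p]*1/[1+k]≡1/[[1+p]*[1+k]] p (i ℕ.+ suc n)))
    (1/n-nonNeg (suc p ℕ.* suc (i ℕ.+ suc n)))
  tail-ratio≤⅓ : ∀ i → tail-ratio i ≤ + 1 / 3
  tail-ratio≤⅓ i = subst (_≤ + 1 / 3) (sym (inv+[1+p]*1/[1+k]≡1/[[1+p]*[1+k]] p (i ℕ.+ suc n)))
    (1/n-antimono-≤ 3 (suc p ℕ.* suc (i ℕ.+ suc n)) (3≤[1+p]*[2+i+n] p i n n≥1))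
  tail₀≡ : tail n 0 ≡ + 1 / (suc p ℕ.* suc n)
  tail₀≡ = trans (tail-zero n) (inv+[1+p]*1/[1+k]≡1/[[1+p]*[1+k]] p n)
  tail₀≥0 : 0ℚ ≤ tail n 0
  tail₀≥0 = subst (0ℚ ≤_) (sym tail₀≡) (1/n-nonNeg (suc p ℕ.* suc n))
  tail₀≤½ : tail n 0 ≤ ½
  tail₀≤½ = subst (_≤ ½) (sym tail₀≡) (1/n-antimono-≤ 2 (suc p ℕ.* suc n) (2≤[1+p]*[1+n] p n n≥1))
  tail≥0 : ∀ i → 0ℚ ≤ tail n i
  tail≥0 = ratio-nonNeg (tail n) (tail-suc n) tail-ratio≥0 tail₀≥0
  tail-sum+¼≤1 : ∀ k → sumℚ (tail n) k + + 1 / 4 ≤ 1ℚ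
  tail-sum+¼≤1 k = begin
    sumℚ (tail n) k + + 1 / 4
      ≤⟨ ℚP.+-monoˡ-≤ (+ 1 / 4)
           (ratio≤⅓⇒sumℚ≤3/2*v₀ (tail n) (tail-suc n) tail-ratio≥0 tail-ratio≤⅓ tail₀≥0 k) ⟩
    + 3 / 2 * tail n 0 + + 1 / 4
      ≤⟨ ℚP.+-monoˡ-≤ (+ 1 / 4) (*-monoˡ-≤-nonNeg (ℚP.nonNegative⁻¹ (+ 3 / 2)) tail₀≤½) ⟩
    + 3 / 2 * ½ + + 1 / 4
      ≡⟨⟩
    1ℚ ∎
    where open ℚP.≤-Reasoning

floor-approx+½-neg : ∀ p n → 1 ℕ.≤ n →
  FloorOfLim (λ m → approx n -[1+ p ] m + ½) (a n -[1+ p ])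
floor-approx+½-neg p n n≥1 = floorOfLim-intro _ (a n r) (suc n) (λ k → sumℚ (tail n) k + ½) ½
  (ℚ.*<* (ℤ.+<+ (ℕ.s≤s ℕ.z≤n))) approx+½≡a+T T≥0 T+½≤1
  where
  r : ℤ
  r = -[1+ p ]
  open ExpSeries r (λ ())
  denominator : ℕ → ℕ
  denominator i = suc p ℕ.* suc (i ℕ.+ suc n)
  tail-suc′ : ∀ i → tail n (suc i) ≡ tail n i * - (+ 1 / denominator i)
  tail-suc′ i = trans (tail-suc n i)
    (cong (tail n i *_) (inv-[1+p]*1/[1+k]≡-1/[[1+p]*[1+k]] p (i ℕ.+ suc n)))
  tail₀∈ : Between -½ 0ℚ (tail n 0)
  tail₀∈ = subst (Between -½ 0ℚ)
    (sym (trans (tail-zero n) (inv-[1+p]*1/[1+k]≡-1/[[1+p]*[1+k]] p n)))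
    ( ℚP.neg-antimono-≤ (1/n-antimono-≤ 2 (suc p ℕ.* suc n) (2≤[1+p]*[1+n] p n n≥1))
    , ℚP.neg-antimono-≤ (1/n-nonNeg (suc p ℕ.* suc n)))
  sum∈ : ∀ k → Between -½ 0ℚ (sumℚ (tail n) k)
  sum∈ k = proj₁ (alternating-sumℚ-between (tail n) tail-suc′
    (λ i → 1/n-nonNeg (denominator i)) (λ i → 1/n-antimono-≤ 1 (denominator i) (ℕ.s≤s ℕ.z≤n))
    (ℚ.*≤* ℤ.-≤+ , ℚP.≤-refl) tail₀∈ k)
  approx+½≡a+T : ∀ k → approx n r (k ℕ.+ suc n) + ½ ≡ fromℤ (a n r) + (sumℚ (tail n) k + ½)
  approx+½≡a+T k = trans (cong (_+ ½) (approx≡a+tail n k)) (ℚP.+-assoc (fromℤ (a n r)) _ ½)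
  T≥0 : ∀ k → 0ℚ ≤ sumℚ (tail n) k + ½
  T≥0 k = ℚP.+-monoˡ-≤ ½ (proj₁ (sum∈ k))
  T+½≤1 : ∀ k → sumℚ (tail n) k + ½ + ½ ≤ 1ℚ
  T+½≤1 k = ℚP.+-monoˡ-≤ ½ (ℚP.+-monoˡ-≤ ½ (proj₂ (sum∈ k)))

theorem4p8 : (r : ℤ) → r ≢ 0ℤ → (n : ℕ) → 1 ℕ.≤ n →
    (r ℤ.< 0ℤ → FloorOfLim (λ m → approx n r m ℚ.+ ½) (a n r)) ×
    (0ℤ ℤ.< r → FloorOfLim (λ m → approx n r m) (a n r))
theorem4p8 (+ zero) r≢0 n n≥1 = contradiction refl r≢0
theorem4p8 +[1+ p ] _   n n≥1 = (λ { (ℤ.+<+ ()) }) , λ _ → floor-approx-pos p n n≥1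
theorem4p8 -[1+ p ] _   n n≥1 = (λ _ → floor-approx+½-neg p n n≥1) , λ ()
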